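{- Let $s\ge 3$ and let $D_s$ be the subdivided cycle on $s$ nodes, with underlying cycle $C_s=(v_1,\ldots,v_s)$. Then for any $u,v\in C_s$, $$\delta_{D_s}(u,v)\ \ge\ \log_2\bigl(1+\delta_{C_s}(u,v)\bigr).$$
   Context: The subdivided cycle $D_s$ ($s\ge 3$) is the graph defined recursively as follows. It contains the cycle $C_s=(v_1,\ldots,v_s)$ (vertices $v_1,\dots,v_s$ with edges $v_iv_{i+1}$ and $v_sv_1$). For $s\in\{3,4\}$, $D_s=C_s$. For $s>4$, add $\lceil s/2\rceil$ new (auxiliary) vertices $u_1,\ldots,u_{\lceil s/2\rceil}$, connect each $v_i$ by an edge to $u_{\lceil i/2\rceil}$, recursively build $D_{\lceil s/2\rceil}$, and identify its cycle $C_{\lceil s/2\rceil}$ with $(u_1,\ldots,u_{\lceil s/2\rceil})$ (in this order). For a graph $H$, $\delta_H(u,v)$ denotes the shortest-path distance (number of edges) between $u$ and $v$ in $H$. -}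

module Defs where

open import Data.Nat using (ℕ; zero; suc; _+_; _≤_; _<_; ⌊_/2⌋; ⌈_/2⌉)
open import Data.Fin using (Fin; toℕ)
open import Data.Product using (_×_; ∃)
open import Data.Sum using (_⊎_)
open import Relation.Binary.PropositionalEquality using (_≡_)

data Walk {A : Set} (R : A → A → Set) : A → A → ℕ → Set where
  [] : ∀ {x} → Walk R x x 0
  _∷_ : ∀ {x y z n} → R x y → Walk R y z n → Walk R x z (suc n)

IsDist : {A : Set} (R : A → A → Set) → A → A → ℕ → Set
IsDist R x y d = Walk R x y d × (∀ n → Walk R x y n → d ≤ n)

-- The cycle C_s on Fin s (0-indexed: vertex i stands for v_{i+1}).
CycStep : (s : ℕ) → Fin s → Fin s → Set
CycStep s i j = (suc (toℕ i) ≡ toℕ j) ⊎ (suc (toℕ i) ≡ s × toℕ j ≡ 0)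

CycAdj : (s : ℕ) → Fin s → Fin s → Set
CycAdj s i j = CycStep s i j ⊎ CycStep s j i

-- Vertices of the subdivided cycle D_s:
-- base i is the cycle vertex v_{i+1}; for s > 4, up h x is the vertex x of
-- the recursively built D_{⌈s/2⌉} (whose cycle vertex base j is u_{j+1}).
data DV : ℕ → Set where
  base : ∀ {s} → Fin s → DV s
  up   : ∀ {s} → 4 < s → DV ⌈ s /2⌉ → DV s

data DAdj : (s : ℕ) → DV s → DV s → Set where
  cyc    : ∀ {s} {i j : Fin s} → CycAdj s i j → DAdj s (base i) (base j)
  spoke  : ∀ {s} (h : 4 < s) (i : Fin s) (j : Fin ⌈ s /2⌉) →
           ⌊ toℕ i /2⌋ ≡ toℕ j → DAdj s (base i) (up h (base j))
  spoke' : ∀ {s} (h : 4 < s) (i : Fin s) (j : Fin ⌈ s /2⌉) →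
           ⌊ toℕ i /2⌋ ≡ toℕ j → DAdj s (up h (base j)) (base i)
  lift   : ∀ {s} (h : 4 < s) {x y : DV ⌈ s /2⌉} →
           DAdj ⌈ s /2⌉ x y → DAdj s (up h x) (up h y)

-- Send a vertex of D_s lying at recursion depth k (a cycle vertex of the k-th nested copy) to
-- the cycle vertex of C_s whose index is 2^k times its own.  Under this projection an edge
-- leaving a vertex of depth k becomes a path of length at most 2^k in C_s, and each step raises
-- the depth by at most one.  A walk of length n in D_s starting on C_s therefore projects to a
-- walk in C_s of length at most 1 + 2 + ⋯ + 2^(n-1) = 2^n - 1.
module Submission where

open import Defs
open import Data.Nat using (ℕ; zero; suc; _+_; _*_; _^_; _≤_; _<_; z≤n; s≤s; ⌊_/2⌋; ⌈_/2⌉)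
open import Data.Nat.Properties
open import Data.Fin using (Fin; toℕ; fromℕ<)
open import Data.Fin.Properties using (toℕ<n; toℕ-fromℕ<; toℕ-injective)
open import Data.Product using (∃-syntax; _×_; _,_)
open import Data.Sum using (_⊎_; inj₁; inj₂; swap)
open import Relation.Binary.Definitions using (Symmetric)
open import Relation.Binary.PropositionalEquality

private
  variable
    A B : Set
    R S : A → A → Set
    s : ℕ

m<⌈n/2⌉⇒m+m<n : ∀ n m → m < ⌈ n /2⌉ → m + m < n
m<⌈n/2⌉⇒m+m<n (suc zero)    zero    _       = s≤s z≤n
m<⌈n/2⌉⇒m+m<n (suc zero)    (suc m) (s≤s ())
m<⌈n/2⌉⇒m+m<n (suc (suc n)) zero    _       = s≤s z≤n
m<⌈n/2⌉⇒m+m<n (suc (suc n)) (suc m) (s≤s p) rewrite +-suc m m =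
  s≤s (s≤s (m<⌈n/2⌉⇒m+m<n n m p))

⌊n/2⌋+⌊n/2⌋+parity≡n : ∀ n → ∃[ r ] r ≤ 1 × ⌊ n /2⌋ + ⌊ n /2⌋ + r ≡ n
⌊n/2⌋+⌊n/2⌋+parity≡n zero          = 0 , z≤n , refl
⌊n/2⌋+⌊n/2⌋+parity≡n (suc zero)    = 1 , ≤-refl , refl
⌊n/2⌋+⌊n/2⌋+parity≡n (suc (suc n)) with ⌊n/2⌋+⌊n/2⌋+parity≡n n
... | r , r≤1 , e = r , r≤1 , cong suc (trans (cong (_+ r) (+-suc h h)) (cong suc e))
  where h = ⌊ n /2⌋

1+m≡⌈n/2⌉⇒n≡1+m+m⊎2+m+m : ∀ n m → suc m ≡ ⌈ n /2⌉ → suc (m + m) ≡ n ⊎ suc (suc (m + m)) ≡ n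
1+m≡⌈n/2⌉⇒n≡1+m+m⊎2+m+m (suc zero)          zero    _ = inj₁ refl
1+m≡⌈n/2⌉⇒n≡1+m+m⊎2+m+m (suc (suc zero))    zero    _ = inj₂ refl
1+m≡⌈n/2⌉⇒n≡1+m+m⊎2+m+m (suc (suc (suc n))) zero    ()
1+m≡⌈n/2⌉⇒n≡1+m+m⊎2+m+m (suc (suc n))       (suc m) e rewrite +-suc m m
  with 1+m≡⌈n/2⌉⇒n≡1+m+m⊎2+m+m n m (suc-injective e)
... | inj₁ w = inj₁ (cong (2 +_) w)
... | inj₂ w = inj₂ (cong (2 +_) w)

Within : (A → A → Set) → A → A → ℕ → Set
Within R x y n = ∃[ l ] l ≤ n × Walk R x y l

_++ʷ_ : ∀ {x y z m n} → Walk R x y m → Walk R y z n → Walk R x z (m + n)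
[]      ++ʷ q = q
(r ∷ p) ++ʷ q = r ∷ (p ++ʷ q)

snoc : ∀ {x y z n} → Walk R x y n → R y z → Walk R x z (suc n)
snoc []      r′ = r′ ∷ []
snoc (r ∷ p) r′ = r ∷ snoc p r′

reverse : Symmetric R → ∀ {x y n} → Walk R x y n → Walk R y x n
reverse sym []      = []
reverse sym (r ∷ p) = snoc (reverse sym p) (sym r)

walk⇒within : ∀ {x y n} → Walk R x y n → Within R x y n
walk⇒within w = _ , ≤-refl , w

within-mono : ∀ {x y m n} → m ≤ n → Within R x y m → Within R x y n
within-mono m≤n (l , l≤m , w) = l , ≤-trans l≤m m≤n , w

within-trans : ∀ {x y z m n} → Within R x y m → Within R y z n → Within R x z (m + n)
within-trans (l , l≤m , p) (l′ , l′≤n , q) = l + l′ , +-mono-≤ l≤m l′≤n , p ++ʷ q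

within-sym : Symmetric R → ∀ {x y n} → Within R x y n → Within R y x n
within-sym sym (l , l≤n , w) = l , l≤n , reverse sym w

within-map : ∀ {c} (f : A → B) → (∀ {x y} → R x y → Within S (f x) (f y) c) →
             ∀ {x y n} → Within R x y n → Within S (f x) (f y) (n * c)
within-map {c = c} f edge (l , l≤n , w) = within-mono (*-monoˡ-≤ c l≤n) (map-walk w)
  where
  map-walk : ∀ {x y l} → Walk _ x y l → Within _ (f x) (f y) (l * c)
  map-walk []      = 0 , z≤n , []
  map-walk (r ∷ p) = within-trans (edge r) (map-walk p)

CycAdj-sym : Symmetric (CycAdj s)
CycAdj-sym = swap

forward : ∀ {d} (i j : Fin s) → toℕ i + d ≡ toℕ j → Walk (CycAdj s) i j d
forward {d = zero} i j e = subst (λ k → Walk _ i k 0) (toℕ-injective (trans (sym (+-identityʳ _)) e)) []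
forward {s} {d = suc d} i j e = inj₁ (inj₁ (sym (toℕ-fromℕ< i+1<s))) ∷ forward next j next+d≡j
  where
  i+1+d≡j : suc (toℕ i + d) ≡ toℕ j
  i+1+d≡j = trans (sym (+-suc (toℕ i) d)) e
  i+1<s : suc (toℕ i) < s
  i+1<s = ≤-<-trans (s≤s (m≤m+n (toℕ i) d)) (subst (_< s) (sym i+1+d≡j) (toℕ<n j))
  next = fromℕ< i+1<s
  next+d≡j : toℕ next + d ≡ toℕ j
  next+d≡j = trans (cong (_+ d) (toℕ-fromℕ< i+1<s)) i+1+d≡j

double : ∀ s → Fin ⌈ s /2⌉ → Fin s
double s a = fromℕ< (m<⌈n/2⌉⇒m+m<n s (toℕ a) (toℕ<n a))

toℕ-double : ∀ s a → toℕ (double s a) ≡ toℕ a + toℕ a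
toℕ-double s a = toℕ-fromℕ< _

double-step : (a b : Fin ⌈ s /2⌉) → CycStep ⌈ s /2⌉ a b → Within (CycAdj s) (double s a) (double s b) 2
double-step {s} a b (inj₁ a+1≡b) = walk⇒within (forward _ _ (begin
  toℕ (double s a) + 2      ≡⟨ cong (_+ 2) (toℕ-double s a) ⟩
  toℕ a + toℕ a + 2         ≡⟨ +-comm _ 2 ⟩
  suc (suc (toℕ a + toℕ a)) ≡⟨ cong suc (sym (+-suc (toℕ a) (toℕ a))) ⟩
  suc (toℕ a) + suc (toℕ a) ≡⟨ cong (λ k → k + k) a+1≡b ⟩
  toℕ b + toℕ b             ≡⟨ toℕ-double s b ⟨
  toℕ (double s b)          ∎))
  where open ≡-Reasoning
-- a is the last vertex of the small cycle, so 2a is the last or the second-to-last vertex of C_s.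
double-step {s} a b (inj₂ (a+1≡⌈s/2⌉ , b≡0)) with 1+m≡⌈n/2⌉⇒n≡1+m+m⊎2+m+m s (toℕ a) a+1≡⌈s/2⌉
... | inj₁ s≡2a+1 = within-mono (s≤s z≤n)
      (walk⇒within (inj₁ (inj₂ (trans (cong suc (toℕ-double s a)) s≡2a+1 , 2b≡0)) ∷ []))
  where 2b≡0 = trans (toℕ-double s b) (cong (λ k → k + k) b≡0)
... | inj₂ s≡2a+2 = walk⇒within (snoc (forward (double s a) last 2a+1≡last)
                                       (inj₁ (inj₂ (trans (cong suc (toℕ-fromℕ< 2a+1<s)) s≡2a+2 , 2b≡0))))
  where
  2b≡0 = trans (toℕ-double s b) (cong (λ k → k + k) b≡0)
  2a+1<s = ≤-reflexive s≡2a+2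
  last = fromℕ< 2a+1<s
  2a+1≡last : toℕ (double s a) + 1 ≡ toℕ last
  2a+1≡last = trans (cong (_+ 1) (toℕ-double s a)) (trans (+-comm _ 1) (sym (toℕ-fromℕ< 2a+1<s)))

double-adj : ∀ {a b} → CycAdj ⌈ s /2⌉ a b → Within (CycAdj s) (double s a) (double s b) 2
double-adj (inj₁ a→b) = double-step _ _ a→b
double-adj (inj₂ b→a) = within-sym CycAdj-sym (double-step _ _ b→a)

double-half : (i : Fin s) (j : Fin ⌈ s /2⌉) → ⌊ toℕ i /2⌋ ≡ toℕ j → Within (CycAdj s) (double s j) i 1
double-half {s} i j i/2≡j with ⌊n/2⌋+⌊n/2⌋+parity≡n (toℕ i)
... | r , r≤1 , i≡2h+r = r , r≤1 , forward _ i
  (trans (cong (_+ r) (trans (toℕ-double s j) (cong (λ k → k + k) (sym i/2≡j)))) i≡2h+r)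

depth : DV s → ℕ
depth (base _) = 0
depth (up _ x) = suc (depth x)

project : DV s → Fin s
project         (base i) = i
project {s = s} (up _ x) = double s (project x)

depth-step : ∀ {x y} → DAdj s x y → depth y ≤ suc (depth x)
depth-step (cyc _)           = z≤n
depth-step (spoke _ _ _ _)   = ≤-refl
depth-step (spoke' _ _ _ _)  = z≤n
depth-step (lift _ x→y)      = s≤s (depth-step x→y)

project-edge : ∀ {x y} → DAdj s x y → Within (CycAdj s) (project x) (project y) (2 ^ depth x)
project-edge (cyc c)            = walk⇒within (c ∷ [])
project-edge (spoke _ i j e)    = within-sym CycAdj-sym (double-half i j e)
project-edge (spoke' _ i j e)   = within-mono (s≤s z≤n) (double-half i j e)
project-edge {s} (lift _ {x} x→y) =
  within-mono (≤-reflexive (*-comm (2 ^ depth x) 2)) (within-map (double s) double-adj (project-edge x→y))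

geometricSum : ℕ → ℕ → ℕ
geometricSum k zero    = 0
geometricSum k (suc n) = 2 ^ k + geometricSum (suc k) n

geometricSum-monoˡ : ∀ n {k k′} → k ≤ k′ → geometricSum k n ≤ geometricSum k′ n
geometricSum-monoˡ zero    _    = z≤n
geometricSum-monoˡ (suc n) k≤k′ = +-mono-≤ (^-monoʳ-≤ 2 k≤k′) (geometricSum-monoˡ n (s≤s k≤k′))

2^k+geometricSum≡2^[k+n] : ∀ k n → 2 ^ k + geometricSum k n ≡ 2 ^ (k + n)
2^k+geometricSum≡2^[k+n] k zero    = trans (+-identityʳ (2 ^ k)) (cong (2 ^_) (sym (+-identityʳ k)))
2^k+geometricSum≡2^[k+n] k (suc n) = begin
  2 ^ k + (2 ^ k + geometricSum (suc k) n) ≡⟨ +-assoc (2 ^ k) _ _ ⟨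
  2 ^ k + 2 ^ k + geometricSum (suc k) n   ≡⟨ cong (λ m → 2 ^ k + m + geometricSum (suc k) n) (+-identityʳ (2 ^ k)) ⟨
  2 ^ suc k + geometricSum (suc k) n       ≡⟨ 2^k+geometricSum≡2^[k+n] (suc k) n ⟩
  2 ^ (suc k + n)                          ≡⟨ cong (2 ^_) (+-suc k n) ⟨
  2 ^ (k + suc n)                          ∎
  where open ≡-Reasoning

project-walk : ∀ {x y n} → Walk (DAdj s) x y n →
               Within (CycAdj s) (project x) (project y) (geometricSum (depth x) n)
project-walk []                 = 0 , z≤n , []
project-walk {n = suc n} (e ∷ p) =
  within-trans (project-edge e) (within-mono (geometricSum-monoˡ n (depth-step e)) (project-walk p))

-- The bound holds for every s.
lemma3 : (s : ℕ) → 3 ≤ s → (i j : Fin s) → (dD dC : ℕ) →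
    IsDist (DAdj s) (base i) (base j) dD →
    IsDist (CycAdj s) i j dC →
    1 + dC ≤ 2 ^ dD
lemma3 s _ i j dD dC (walkD , _) (_ , minimalC) with project-walk walkD
... | l , l≤sum , walkC = begin
  1 + dC                ≤⟨ s≤s (minimalC l walkC) ⟩
  1 + l                 ≤⟨ s≤s l≤sum ⟩
  1 + geometricSum 0 dD ≡⟨ 2^k+geometricSum≡2^[k+n] 0 dD ⟩
  2 ^ dD                ∎
  where open ≤-Reasoning
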